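{- Let $n\ge1$, $w\in\mathfrak{S}_{n+1}$, $\sigma\in\operatorname{Sym}(n)$ and $\lambda(w,\sigma)=(\lambda_1,\dots,\lambda_n)$. Then $\{|\lambda_1|,\dots,|\lambda_n|\}=\{2,\dots,n+1\}$.
   Context: $\operatorname{Sym}(n)$ is the set of permutations of $\{1,\dots,n\}$. For $w\in\mathfrak{S}_{n+1}$ in one-line notation $w_1\cdots w_{n+1}$ and $\sigma\in\operatorname{Sym}(n)$: start with the set composition $\{w_1\}|\cdots|\{w_{n+1}\}$ of $\{1,\dots,n+1\}$, bar $j$ ($1\le j\le n$) being the separator between $w_j$ and $w_{j+1}$. For $k=1,\dots,n$, at step $k$ remove bar $\sigma(k)$, merging the two consecutive blocks $B|B'$ it separates into $B\cup B'$. Set $\lambda_k=\varepsilon\cdot\max\{\min B,\min B'\}$ with $\varepsilon=+1$ if $\min B<\min B'$ and $\varepsilon=-1$ otherwise; $\lambda(w,\sigma)=(\lambda_1,\dots,\lambda_n)$. -}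

module Defs where

open import Data.Nat using (ℕ; zero; suc; _⊓_; _<ᵇ_; _≡ᵇ_)
open import Data.Integer using (ℤ; +_; -_)
open import Data.Bool using (if_then_else_)
open import Data.Fin using (Fin; toℕ)
open import Data.Fin.Permutation using (Permutation′; _⟨$⟩ʳ_)
open import Data.List using (List; []; _∷_; map; allFin; tabulate)
open import Data.List.NonEmpty using (List⁺; [_]; _⁺++⁺_; foldr₁)
open import Data.Maybe using (Maybe; just; nothing)
open import Data.Product using (_×_; _,_)

-- A block of a set composition: a nonempty list of elements of {1,..,n+1}.
Block : Set
Block = List⁺ ℕ

minB : Block → ℕ
minB = foldr₁ _⊓_

-- A set composition B₀ | B₁ | ... | Bₘ together with the (original) labels
-- of the bars still present: (B₀ , [(j₁ , B₁) , ... , (jₘ , Bₘ)]) means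
-- that bar jᵢ separates B_{i-1} from Bᵢ.
Comp : Set
Comp = Block × List (ℕ × Block)

-- λ-value for merging B | B' :  ε · max{min B, min B'}
lamVal : Block → Block → ℤ
lamVal B B' = if minB B <ᵇ minB B' then + minB B' else - (+ minB B)

removeBar′ : ℕ → Block → List (ℕ × Block) → Maybe (Comp × ℤ)
removeBar′ j B [] = nothing
removeBar′ j B ((j' , B') ∷ rest) with j ≡ᵇ j'
... | Data.Bool.true = just ((B ⁺++⁺ B' , rest) , lamVal B B')
... | Data.Bool.false with removeBar′ j B' rest
...   | nothing = nothing
...   | just ((C , rest') , l) = just ((B , (j' , C) ∷ rest') , l)

removeBar : ℕ → Comp → Maybe (Comp × ℤ)
removeBar j (B , rest) = removeBar′ j B rest

runBars : List ℕ → Comp → Maybe (List ℤ)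
runBars [] c = just []
runBars (j ∷ js) c with removeBar j c
... | nothing = nothing
... | just (c' , l) with runBars js c'
...   | nothing = nothing
...   | just ls = just (l ∷ ls)

-- w ∈ S_{n+1} in one-line notation: w_{i+1} = 1 + toℕ (w ⟨$⟩ʳ i).
wval : ∀ {n} → Permutation′ (suc n) → Fin (suc n) → ℕ
wval w i = suc (toℕ (w ⟨$⟩ʳ i))

-- Initial composition {w₁} | {w₂} | ... | {w_{n+1}}, bar j between w_j, w_{j+1}.
initComp : ∀ n → Permutation′ (suc n) → Comp
initComp n w = ([ wval w Fin.zero ] ,
               tabulate (λ (j : Fin n) → (suc (toℕ j) , [ wval w (Fin.suc j) ])))

-- The bar order σ(1), ..., σ(n) for σ ∈ Sym(n): σ(k+1) = 1 + toℕ (σ ⟨$⟩ʳ k).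
barOrder : ∀ n → Permutation′ n → List ℕ
barOrder n σ = map (λ k → suc (toℕ (σ ⟨$⟩ʳ k))) (allFin n)

-- λ(w, σ) = (λ₁, ..., λₙ)  (nothing only if some bar were missing, which
-- cannot happen for a permutation σ).
lambda : ∀ n → Permutation′ (suc n) → Permutation′ n → Maybe (List ℤ)
lambda n w σ = runBars (barOrder n σ) (initComp n w)

{-# OPTIONS --safe #-}
module Submission where

-- Removing the bar between B and B' replaces min B and min B' in the multiset
-- of block minima by min (B ∪ B') and emits |λ| = max (min B, min B').  So the
-- initial minima w₁, …, w_{n+1}, i.e. 1, …, n+1, are a rearrangement of the
-- minimum of the final block together with |λ₁|, …, |λₙ|.  Each emitted value
-- dominates a minimum that is still present, so the final minimum is a lower
-- bound of all initial ones: it is 1, and the |λₖ| are exactly 2, …, n+1.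

open import Defs
open import Data.Nat using (ℕ; suc; _≤_; _⊓_; _⊔_; _<ᵇ_; _≡ᵇ_; z≤n; s≤s)
open import Data.Nat.Properties
open import Data.Integer using (ℤ; ∣_∣; +_)
open import Data.Integer.Properties using (∣-i∣≡∣i∣)
open import Data.Fin using (Fin; toℕ; fromℕ<)
open import Data.Fin.Properties using (toℕ-injective; toℕ<n; toℕ-fromℕ<)
open import Data.Fin.Permutation using (Permutation′; _⟨$⟩ʳ_; _⟨$⟩ˡ_; inverseʳ)
open import Data.List using (List; []; _∷_; map; length; tabulate; allFin)
open import Data.List.Properties using (length-map; length-tabulate; map-tabulate)
open import Data.List.NonEmpty using (_⁺++⁺_) renaming (_∷_ to _∷⁺_)
open import Data.List.Membership.Propositional using (_∈_)
open import Data.List.Membership.Propositional.Properties using (∈-tabulate⁺; ∈-tabulate⁻)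
open import Data.List.Relation.Unary.Any using (Any; here; there)
open import Data.List.Relation.Unary.All using (All; []; _∷_)
import Data.List.Relation.Unary.All as All
import Data.List.Relation.Unary.All.Properties as All
open import Data.List.Relation.Unary.AllPairs using (_∷_)
open import Data.List.Relation.Unary.Unique.Propositional using (Unique)
import Data.List.Relation.Unary.Unique.Propositional.Properties as Unique
open import Data.List.Relation.Binary.Permutation.Propositional
  using (_↭_; ↭-refl; ↭-sym; ↭-trans; ↭-prep; ↭-swap; ↭⇒↭ₛ)
open import Data.List.Relation.Binary.Permutation.Propositional.Properties
  using (∈-resp-↭; All-resp-↭; ↭-length)
import Data.List.Relation.Binary.Permutation.Setoid.Properties as Permutationₛ
open import Data.Maybe using (just)
open import Data.Product using (Σ; _×_; _,_; proj₁; proj₂; uncurry)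
open import Data.Sum using (inj₁; inj₂)
open import Data.Bool using (true; false; T)
open import Data.Unit using (tt)
open import Function.Bundles using (_⇔_; mk⇔; Injection; Equivalence)
open import Function.Properties.Inverse using (↔⇒↣)
open import Relation.Nullary using (contradiction)
open import Relation.Binary.PropositionalEquality

labels : List (ℕ × Block) → List ℕ
labels = map proj₁

blockMinima : Comp → List ℕ
blockMinima (B , rest) = minB B ∷ map (λ (_ , B') → minB B') rest

↭-prep-swap : ∀ {A : Set} {x y : A} {xs ys} → xs ↭ y ∷ ys → x ∷ xs ↭ y ∷ x ∷ ys
↭-prep-swap {x = x} {y} p = ↭-trans (↭-prep x p) (↭-swap x y ↭-refl)

↭-⊔∷⊓ : ∀ a b (M : List ℕ) → a ∷ b ∷ M ↭ a ⊔ b ∷ a ⊓ b ∷ M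
↭-⊔∷⊓ a b M with ≤-total a b
... | inj₁ a≤b rewrite m≤n⇒m⊔n≡n a≤b | m≤n⇒m⊓n≡m a≤b = ↭-swap a b ↭-refl
... | inj₂ b≤a rewrite m≥n⇒m⊔n≡m b≤a | m≥n⇒m⊓n≡n b≤a = ↭-refl

minB-⁺++⁺ : ∀ B B' → minB (B ⁺++⁺ B') ≡ minB B ⊓ minB B'
minB-⁺++⁺ (x ∷⁺ xs) B' = go x xs
  where
  open ≡-Reasoning
  go : ∀ x xs → minB ((x ∷⁺ xs) ⁺++⁺ B') ≡ minB (x ∷⁺ xs) ⊓ minB B'
  go x [] = refl
  go x (y ∷ xs) = begin
    x ⊓ minB ((y ∷⁺ xs) ⁺++⁺ B')    ≡⟨ cong (x ⊓_) (go y xs) ⟩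
    x ⊓ (minB (y ∷⁺ xs) ⊓ minB B')  ≡⟨ ⊓-assoc x _ _ ⟨
    x ⊓ minB (y ∷⁺ xs) ⊓ minB B'    ∎

∣lamVal∣≡⊔ : ∀ B B' → ∣ lamVal B B' ∣ ≡ minB B ⊔ minB B'
∣lamVal∣≡⊔ B B' with minB B <ᵇ minB B' in lt
... | true  = sym (m≤n⇒m⊔n≡n (<⇒≤ (<ᵇ⇒< (minB B) (minB B') (subst T (sym lt) tt))))
... | false = trans (∣-i∣≡∣i∣ (+ minB B))
                    (sym (m≥n⇒m⊔n≡m (≮⇒≥ λ a<b → subst T lt (<⇒<ᵇ a<b))))

↭-merge-minima : ∀ B B' M →
  minB B ∷ minB B' ∷ M ↭ ∣ lamVal B B' ∣ ∷ minB (B ⁺++⁺ B') ∷ M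
↭-merge-minima B B' M rewrite ∣lamVal∣≡⊔ B B' | minB-⁺++⁺ B B' = ↭-⊔∷⊓ (minB B) (minB B') M

minB-merge≤∣lamVal∣ : ∀ B B' → minB (B ⁺++⁺ B') ≤ ∣ lamVal B B' ∣
minB-merge≤∣lamVal∣ B B' rewrite ∣lamVal∣≡⊔ B B' | minB-⁺++⁺ B B' = m⊓n≤m⊔n (minB B) (minB B')

removeBar′-here : ∀ {j j' B B' rest} → (j ≡ᵇ j') ≡ true →
  removeBar′ j B ((j' , B') ∷ rest) ≡ just ((B ⁺++⁺ B' , rest) , lamVal B B')
removeBar′-here e rewrite e = refl

removeBar′-there : ∀ {j j' B B' rest C rest' l} → (j ≡ᵇ j') ≡ false →
  removeBar′ j B' rest ≡ just ((C , rest') , l) →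
  removeBar′ j B ((j' , B') ∷ rest) ≡ just ((B , (j' , C) ∷ rest') , l)
removeBar′-there e e' rewrite e | e' = refl

record BarRemoval (j : ℕ) (B : Block) (rest : List (ℕ × Block)) : Set where
  field
    head  : Block
    tail  : List (ℕ × Block)
    value : ℤ
    computes   : removeBar′ j B rest ≡ just ((head , tail) , value)
    labels-↭   : labels rest ↭ j ∷ labels tail
    minima-↭   : blockMinima (B , rest) ↭ ∣ value ∣ ∷ blockMinima (head , tail)
    dominates  : Any (_≤ ∣ value ∣) (blockMinima (head , tail))

removeBar′-spec : ∀ j B rest → j ∈ labels rest → BarRemoval j B rest
removeBar′-spec j B ((j' , B') ∷ rest) j∈ with j ≡ᵇ j' in e
... | true with refl ← ≡ᵇ⇒≡ j j' (subst T (sym e) tt) = record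
  { head      = B ⁺++⁺ B'
  ; tail      = rest
  ; value     = lamVal B B'
  ; computes  = removeBar′-here {j} e
  ; labels-↭  = ↭-refl
  ; minima-↭  = ↭-merge-minima B B' _
  ; dominates = here (minB-merge≤∣lamVal∣ B B')
  }
... | false = record
  { head      = B
  ; tail      = (j' , r.head) ∷ r.tail
  ; value     = r.value
  ; computes  = removeBar′-there {j} {j'} e r.computes
  ; labels-↭  = ↭-prep-swap r.labels-↭
  ; minima-↭  = ↭-prep-swap r.minima-↭
  ; dominates = there r.dominates
  }
  where
  j∈rest : j ∈ j' ∷ labels rest → j ∈ labels rest
  j∈rest (here refl) = contradiction (≡⇒≡ᵇ j j refl) (subst T e)
  j∈rest (there j∈) = j∈
  module r = BarRemoval (removeBar′-spec j B' rest (j∈rest j∈))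

runBars-∷ : ∀ {j js c c' l ls} → removeBar j c ≡ just (c' , l) → runBars js c' ≡ just ls →
  runBars (j ∷ js) c ≡ just (l ∷ ls)
runBars-∷ e e' rewrite e | e' = refl

record BarRun (js : List ℕ) (c : Comp) : Set where
  field
    values   : List ℤ
    computes : runBars js c ≡ just values
    final    : ℕ
    minima-↭ : blockMinima c ↭ final ∷ map ∣_∣ values
    final-≤  : All (final ≤_) (blockMinima c)

runBars-spec : ∀ js B rest → Unique js → All (_∈ labels rest) js →
  length (labels rest) ≡ length js → BarRun js (B , rest)
runBars-spec [] B [] _ _ _ = record
  { values = [] ; computes = refl ; final = minB B ; minima-↭ = ↭-refl ; final-≤ = ≤-refl ∷ [] }
runBars-spec (j ∷ js) B rest (j∉js ∷ js-unique) (j∈ ∷ js⊆) len = record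
  { values   = r.value ∷ values
  ; computes = runBars-∷ {j} {js} {B , rest} r.computes computes
  ; final    = final
  ; minima-↭ = ↭-trans r.minima-↭ (↭-prep-swap minima-↭)
  ; final-≤  = All-resp-↭ (↭-sym r.minima-↭)
                 (uncurry ≤-trans (All.lookupAny final-≤ r.dominates) ∷ final-≤)
  }
  where
  module r = BarRemoval (removeBar′-spec j B rest j∈)
  ∈-labels-tail : ∀ {x} → x ∈ labels rest × j ≢ x → x ∈ labels r.tail
  ∈-labels-tail (x∈ , j≢x) with ∈-resp-↭ r.labels-↭ x∈
  ... | here x≡j = contradiction (sym x≡j) j≢x
  ... | there x∈tail = x∈tail
  open BarRun (runBars-spec js r.head r.tail js-unique
                 (All.zipWith ∈-labels-tail (js⊆ , j∉js))
                 (suc-injective (trans (sym (↭-length r.labels-↭)) len)))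

∈-range-drop-minimum : ∀ {N m xs ys} → (∀ x → x ∈ xs ⇔ (1 ≤ x × x ≤ N)) → Unique xs →
  xs ↭ m ∷ ys → All (m ≤_) xs → ∀ x → x ∈ ys ⇔ (2 ≤ x × x ≤ N)
∈-range-drop-minimum {N} {m} {xs} {ys} range xs-unique xs↭ m≤ x = mk⇔ to from
  where
  bounds : ∀ y → y ∈ xs → 1 ≤ y × y ≤ N
  bounds y = Equivalence.to (range y)
  ∈xs : ∀ y → 1 ≤ y × y ≤ N → y ∈ xs
  ∈xs y = Equivalence.from (range y)
  m≡1 : m ≡ 1
  m≡1 = let 1≤m , m≤N = bounds m (∈-resp-↭ (↭-sym xs↭) (here refl))
        in ≤-antisym (All.lookup m≤ (∈xs 1 (≤-refl , ≤-trans 1≤m m≤N))) 1≤m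
  m∉ys : All (m ≢_) ys
  m∉ys with m∉ys ∷ _ ← Permutationₛ.Unique-resp-↭ (setoid ℕ) (↭⇒↭ₛ xs↭) xs-unique = m∉ys
  to : x ∈ ys → 2 ≤ x × x ≤ N
  to x∈ys = let 1≤x , x≤N = bounds x (∈-resp-↭ (↭-sym xs↭) (there x∈ys))
            in ≤∧≢⇒< 1≤x (λ 1≡x → All.lookup m∉ys x∈ys (trans m≡1 1≡x)) , x≤N
  from : 2 ≤ x × x ≤ N → x ∈ ys
  from (2≤x , x≤N) with ∈-resp-↭ xs↭ (∈xs x (<⇒≤ 2≤x , x≤N))
  ... | here x≡m = contradiction (trans x≡m m≡1) (λ x≡1 → <⇒≢ 2≤x (sym x≡1))
  ... | there x∈ys = x∈ys

permute-suc-toℕ-injective : ∀ {m} (π : Permutation′ m) {i j} →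
  suc (toℕ (π ⟨$⟩ʳ i)) ≡ suc (toℕ (π ⟨$⟩ʳ j)) → i ≡ j
permute-suc-toℕ-injective π e = Injection.injective (↔⇒↣ π) (toℕ-injective (suc-injective e))

oneLine-unique : ∀ {n} (w : Permutation′ (suc n)) → Unique (tabulate (wval w))
oneLine-unique w = Unique.tabulate⁺ (permute-suc-toℕ-injective w)

∈-oneLine⇔ : ∀ {n} (w : Permutation′ (suc n)) x → x ∈ tabulate (wval w) ⇔ (1 ≤ x × x ≤ suc n)
∈-oneLine⇔ {n} w x = mk⇔ to from
  where
  to : x ∈ tabulate (wval w) → 1 ≤ x × x ≤ suc n
  to x∈ with i , refl ← ∈-tabulate⁻ {f = wval w} x∈ = s≤s z≤n , toℕ<n (w ⟨$⟩ʳ i)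
  from : 1 ≤ x × x ≤ suc n → x ∈ tabulate (wval w)
  from (s≤s z≤n , y<) = subst (_∈ tabulate (wval w)) wval-preimage (∈-tabulate⁺ {f = wval w} _)
    where
    wval-preimage : wval w (w ⟨$⟩ˡ fromℕ< y<) ≡ x
    wval-preimage = cong suc (trans (cong toℕ (inverseʳ w)) (toℕ-fromℕ< y<))

blockMinima-initComp : ∀ n w → blockMinima (initComp n w) ≡ tabulate (wval w)
blockMinima-initComp n w = cong (wval w Fin.zero ∷_) (map-tabulate _ _)

labels-initComp : ∀ n w → labels (proj₂ (initComp n w)) ≡ tabulate (λ (j : Fin n) → suc (toℕ j))
labels-initComp n w = map-tabulate _ proj₁

barOrder-unique : ∀ n σ → Unique (barOrder n σ)
barOrder-unique n σ = Unique.map⁺ (permute-suc-toℕ-injective σ) (Unique.allFin⁺ n)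

barOrder-⊆-labels : ∀ n w σ → All (_∈ labels (proj₂ (initComp n w))) (barOrder n σ)
barOrder-⊆-labels n w σ rewrite labels-initComp n w =
  All.map⁺ (All.tabulate⁺ (λ k → ∈-tabulate⁺ (σ ⟨$⟩ʳ k)))

length-labels-initComp : ∀ n w σ → length (labels (proj₂ (initComp n w))) ≡ length (barOrder n σ)
length-labels-initComp n w σ = begin
  length (labels (proj₂ (initComp n w)))           ≡⟨ cong length (labels-initComp n w) ⟩
  length (tabulate (λ (j : Fin n) → suc (toℕ j)))  ≡⟨ length-tabulate _ ⟩
  n                                                ≡⟨ length-tabulate _ ⟨
  length (allFin n)                                ≡⟨ length-map _ (allFin n) ⟨
  length (barOrder n σ)                            ∎
  where open ≡-Reasoning

lemma2p4 : (n : ℕ) → 1 ≤ n → (w : Permutation′ (suc n)) → (σ : Permutation′ n) →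
    Σ (List ℤ) (λ ls → (lambda n w σ ≡ just ls) ×
      ((x : ℕ) → (x ∈ map ∣_∣ ls) ⇔ ((2 ≤ x) × (x ≤ suc n))))
lemma2p4 n _ w σ = values , computes ,
  ∈-range-drop-minimum (∈-oneLine⇔ w) (oneLine-unique w)
    (subst (_↭ final ∷ map ∣_∣ values) (blockMinima-initComp n w) minima-↭)
    (subst (All (final ≤_)) (blockMinima-initComp n w) final-≤)
  where
  open BarRun (runBars-spec (barOrder n σ) _ _ (barOrder-unique n σ) (barOrder-⊆-labels n w σ)
                 (length-labels-initComp n w σ))
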